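{- Let $p$ be an odd prime and $i\in\{1,2\}$. Then the rogue set $A_i^p$ is generated if and only if $(-1)^{i+1} \bmod p$ is a $p^{\text{th}}$ rogue generator of the $i^{\text{th}}$ kind, i.e. if and only if the underlying set of the rogue sequence $\langle (-1)^{i+1}\rangle_i^p$ equals $A_i^p$.
   Context: For an odd prime $p$ and $i\in\{1,2\}$, the rogue set of the $i^{\text{th}}$ kind is $A_i^p=(\mathbb{Z}/p\mathbb{Z})^\times\setminus\{(-1)^i \bmod p\}$ (so $A_1^p=\{1,\dots,p-2\}$ and $A_2^p=\{2,\dots,p-1\}$ mod $p$). For $g\in A_i^p$ define $u_1=g$ and $u_n=2u_{n-1}+(-1)^{i+1}$ in $\mathbb{Z}/p\mathbb{Z}$ for $n>1$; let $g_k^i=\min(\{n\in\mathbb{N}: u_n=0\}\cup\{\infty\})$. The rogue sequence of $g$ is $\langle g\rangle_i^p=(u_n)_{1\le n<g_k^i}$. $A_i^p$ is called generated if there exists $g\in A_i^p$ such that the set of terms of $\langle g\rangle_i^p$ equals $A_i^p$ (ordering ignored); such a $g$ is called a $p^{\text{th}}$ rogue generator of the $i^{\text{th}}$ kind. -}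

module Defs where

open import Data.Nat using (ℕ; zero; suc; _+_; _*_; _∸_; _≤_; _<_; NonZero)
open import Data.Nat.DivMod using (_%_)
open import Data.Product using (Σ; _×_; ∃-syntax)
open import Relation.Binary.PropositionalEquality using (_≡_)
open import Relation.Nullary using (¬_)
open import Function.Bundles using (_⇔_)

-- Elements of ℤ/pℤ are represented by their canonical representatives
-- 0 ≤ x < p in ℕ.

data Kind : Set where
  first second : Kind

-- (-1)^(i+1) mod p : the additive constant of the recursion
--   (first: +1, second: -1 ≡ p-1 mod p).
sgn : (p : ℕ) → .{{NonZero p}} → Kind → ℕ
sgn p first  = 1 % p
sgn p second = (p ∸ 1) % p

-- (-1)^i mod p : the element removed from (ℤ/pℤ)^×
--   (first: -1 ≡ p-1, second: +1).
excluded : (p : ℕ) → .{{NonZero p}} → Kind → ℕ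
excluded p first  = (p ∸ 1) % p
excluded p second = 1 % p

-- Membership in the rogue set A_i^p = (ℤ/pℤ)^× ∖ {(-1)^i mod p}
-- (for p prime, (ℤ/pℤ)^× = {1,…,p-1}).
InRogueSet : (p : ℕ) → .{{NonZero p}} → Kind → ℕ → Set
InRogueSet p i x = (1 ≤ x) × (x < p) × ¬ (x ≡ excluded p i)

-- u_n for n ≥ 1, indexed from 0:  rogueTerm p i g n = u_{n+1},
-- u_1 = g, u_{n} = 2 u_{n-1} + (-1)^(i+1)  (mod p).
rogueTerm : (p : ℕ) → .{{NonZero p}} → Kind → ℕ → ℕ → ℕ
rogueTerm p i g zero    = g % p
rogueTerm p i g (suc n) = (2 * rogueTerm p i g n + sgn p i) % p

-- x is a term of the rogue sequence ⟨g⟩_i^p = (u_n)_{1 ≤ n < g_k^i}: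
-- x = u_{n+1} with u_{m+1} ≠ 0 for all m ≤ n (i.e. n+1 < g_k^i, where
-- g_k^i is the least index of a zero, or ∞ if there is none).
InRogueSeq : (p : ℕ) → .{{NonZero p}} → Kind → ℕ → ℕ → Set
InRogueSeq p i g x =
  ∃[ n ] ((∀ m → m ≤ n → ¬ (rogueTerm p i g m ≡ 0)) × (rogueTerm p i g n ≡ x))

SeqSetIsRogueSet : (p : ℕ) → .{{NonZero p}} → Kind → ℕ → Set
SeqSetIsRogueSet p i g = ∀ x → x < p → (InRogueSeq p i g x ⇔ InRogueSet p i x)

IsRogueGenerator : (p : ℕ) → .{{NonZero p}} → Kind → ℕ → Set
IsRogueGenerator p i g = InRogueSet p i g × SeqSetIsRogueSet p i g

Generated : (p : ℕ) → .{{NonZero p}} → Kind → Set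
Generated p i = ∃[ g ] IsRogueGenerator p i g

{-# OPTIONS --safe #-}
module Submission where

-- The constant c = (-1)^(i+1) lies in A_i^p, so any generator g must produce it.
-- It cannot occur at a later position: u_{n+1} = 2 u_n + c ≡ c forces p ∣ 2 u_n,
-- impossible for odd p since u_n ≢ 0 while the sequence runs. Hence c = u_1 = g.

open import Defs
open import Data.Nat using (ℕ; NonZero)
open import Data.Nat.Primality using (Prime)
open import Relation.Binary.PropositionalEquality using (_≢_)
open import Function.Bundles using (_⇔_)

open import Data.Nat
  using (zero; suc; _+_; _*_; _<_; z≤n; s≤s)
open import Data.Nat.Properties
  using (+-comm; +-cancelʳ-≡; ≤-refl; n≤1+n; n≢0⇒n>0)
open import Data.Nat.DivMod using (_%_; _/_; m%n<n; m<n⇒m%n≡m; m≡m%n+[m/n]*n)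
open import Data.Nat.Divisibility using (_∣_; _∤_; divides; >⇒∤)
open import Data.Nat.Primality using (euclidsLemma; prime⇒nonTrivial)
open import Data.Product using (_,_; proj₁; proj₂)
open import Data.Sum using ([_,_]′)
open import Data.Empty using (⊥-elim)
open import Relation.Binary.PropositionalEquality
  using (_≡_; refl; sym; trans; cong; subst; module ≡-Reasoning)
open import Function.Bundles using (mk⇔; Equivalence)

[m+n]%d≡n⇒d∣m : ∀ m n d .{{_ : NonZero d}} → (m + n) % d ≡ n → d ∣ m
[m+n]%d≡n⇒d∣m m n d eq = divides q (+-cancelʳ-≡ n m (q * d) m+n≡q*d+n)
  where
  open ≡-Reasoning
  q : ℕ
  q = (m + n) / d
  m+n≡q*d+n : m + n ≡ q * d + n
  m+n≡q*d+n = begin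
    m + n                ≡⟨ m≡m%n+[m/n]*n (m + n) d ⟩
    (m + n) % d + q * d  ≡⟨ cong (_+ q * d) eq ⟩
    n + q * d            ≡⟨ +-comm n (q * d) ⟩
    q * d + n            ∎

prime>2⇒∤2* : ∀ {p t} → Prime p → 2 < p → 0 < t → t < p → p ∤ 2 * t
prime>2⇒∤2* {t = suc _} pr 2<p _ t<p p∣2t =
  [ >⇒∤ 2<p , >⇒∤ t<p ]′ (euclidsLemma 2 _ pr p∣2t)

[p∸1]%p≡p∸1 : ∀ k → (2 + k) % (3 + k) ≡ 2 + k
[p∸1]%p≡p∸1 k = m<n⇒m%n≡m ≤-refl

sgn∈RogueSet : ∀ k i → InRogueSet (3 + k) i (sgn (3 + k) i)
sgn∈RogueSet k first =
  s≤s z≤n , s≤s (s≤s z≤n) , λ 1≡p∸1 → 1≢2+k (trans 1≡p∸1 ([p∸1]%p≡p∸1 k))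
  where
  1≢2+k : 1 ≢ 2 + k
  1≢2+k ()
sgn∈RogueSet k second rewrite [p∸1]%p≡p∸1 k = s≤s z≤n , ≤-refl , λ ()

module _ (p : ℕ) .{{_ : NonZero p}} (i : Kind) where

  rogueTerm<p : ∀ g n → rogueTerm p i g n < p
  rogueTerm<p g zero    = m%n<n g p
  rogueTerm<p g (suc n) = m%n<n (2 * rogueTerm p i g n + sgn p i) p

  module _ (pr : Prime p) (2<p : 2 < p) where

    sgn∉laterTerm : ∀ g n → rogueTerm p i g n ≢ 0 → rogueTerm p i g (suc n) ≢ sgn p i
    sgn∉laterTerm g n uₙ≢0 uₙ₊₁≡c =
      prime>2⇒∤2* pr 2<p (n≢0⇒n>0 uₙ≢0) (rogueTerm<p g n)
        ([m+n]%d≡n⇒d∣m (2 * rogueTerm p i g n) (sgn p i) p uₙ₊₁≡c)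

    sgn∈RogueSeq⇒≡sgn : ∀ {g} → g < p → InRogueSeq p i g (sgn p i) → g ≡ sgn p i
    sgn∈RogueSeq⇒≡sgn g<p (zero , _ , u₁≡c) = trans (sym (m<n⇒m%n≡m g<p)) u₁≡c
    sgn∈RogueSeq⇒≡sgn {g} _ (suc n , nonzero , uₙ₊₂≡c) =
      ⊥-elim (sgn∉laterTerm g n (nonzero n (n≤1+n n)) uₙ₊₂≡c)

    generated⇔sgnGenerates : InRogueSet p i (sgn p i) →
                             Generated p i ⇔ IsRogueGenerator p i (sgn p i)
    generated⇔sgnGenerates c∈A = mk⇔ to (sgn p i ,_)
      where
      c<p : sgn p i < p
      c<p = proj₁ (proj₂ c∈A)
      to : Generated p i → IsRogueGenerator p i (sgn p i)
      to (g , gen@(g∈A , seq≡A)) =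
        subst (IsRogueGenerator p i)
          (sgn∈RogueSeq⇒≡sgn (proj₁ (proj₂ g∈A)) (Equivalence.from (seq≡A _ c<p) c∈A))
          gen

mainTheorem1 : (p : ℕ) → .{{_ : NonZero p}} → Prime p → p ≢ 2 → (i : Kind) →
    Generated p i ⇔ IsRogueGenerator p i (sgn p i)
mainTheorem1 1 pr _ i with () ← prime⇒nonTrivial pr
mainTheorem1 2 _ p≢2 i = ⊥-elim (p≢2 refl)
mainTheorem1 (suc (suc (suc k))) pr _ i =
  generated⇔sgnGenerates (3 + k) i pr (s≤s (s≤s (s≤s z≤n))) (sgn∈RogueSet k i)
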